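{- Let $A$ be an ordered set and, for each $a\in A$, let $M_a=\langle R_a,\circ_a,e_a,-_a,\infty_a\rangle$ be a CBI-model. Let $R=\prod_{a\in A}R_a$ (tuples $(x_a)_{a\in A}$), and define $-((x_a)_{a})=(-_a x_a)_{a}$ and $(x_a)_a\circ(y_a)_a=\{(w_a)_a \mid w_a\in x_a\circ_a y_a \text{ for all } a\in A\}$. Then $\langle R,\circ,(e_a)_a,-,(\infty_a)_a\rangle$ is a CBI-model.
   Context: A BBI-model is $\langle R,\circ,e\rangle$ with $e\in R$, $\circ:R\times R\to\mathcal{P}(R)$ commutative and associative (w.r.t. the pointwise extension $X\circ Y=\bigcup_{x\in X,y\in Y}x\circ y$) with $r\circ e=\{r\}$ for all $r$. A CBI-model is $\langle R,\circ,e,-,\infty\rangle$ with $\langle R,\circ,e\rangle$ a BBI-model, $-:R\to R$, $\infty\in R$, such that for each $x$, $-x$ is the unique element with $\infty\in x\circ(-x)$. -}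

module Defs where

open import Level using (Level; _⊔_; suc)
open import Data.Product using (Σ; ∃; _×_; _,_; proj₁; proj₂)
open import Relation.Binary.Bundles using (Setoid)
open import Relation.Binary.Structures using (IsEquivalence)

-- Subsets of a setoid carrier are predicates; ∈ is application.
-- Set equality X = Y is mutual inclusion (X ⊆ Y and Y ⊆ X).

module _ {c ℓ : Level} (S : Setoid c ℓ) where
  open Setoid S renaming (Carrier to R)

  -- Pointwise extension X ∘ Y = ⋃_{x∈X, y∈Y} x ∘ y, for X = a singleton
  -- on the left / right (all that is needed to state associativity).
  record IsBBI {p : Level} (_∘_ : R → R → R → Set p) (e : R) : Set (suc (c ⊔ ℓ ⊔ p)) where
    field
      ∘-resp-elem : ∀ {x y w w′} → w ≈ w′ → (x ∘ y) w → (x ∘ y) w′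
      ∘-resp-≈    : ∀ {x x′ y y′ w} → x ≈ x′ → y ≈ y′ → (x ∘ y) w → (x′ ∘ y′) w
      comm  : ∀ x y w → (x ∘ y) w → (y ∘ x) w
      assoc₁ : ∀ x y z w → (∃ λ t → (x ∘ y) t × (t ∘ z) w)
                         → (∃ λ t → (y ∘ z) t × (x ∘ t) w)
      assoc₂ : ∀ x y z w → (∃ λ t → (y ∘ z) t × (x ∘ t) w)
                         → (∃ λ t → (x ∘ y) t × (t ∘ z) w)
      unit₁ : ∀ r w → (r ∘ e) w → w ≈ r
      unit₂ : ∀ r → (r ∘ e) r

  record IsCBI {p : Level} (_∘_ : R → R → R → Set p) (e : R) (-_ : R → R) (∞ : R)
         : Set (suc (c ⊔ ℓ ⊔ p)) where
    field
      isBBI  : IsBBI _∘_ e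
      inv    : ∀ x → (x ∘ (- x)) ∞
      inv-unique : ∀ x y → (x ∘ y) ∞ → y ≈ (- x)

record CBIModel (c ℓ p : Level) : Set (suc (c ⊔ ℓ ⊔ p)) where
  field
    setoid : Setoid c ℓ
  open Setoid setoid public renaming (Carrier to R)
  field
    _∘_ : R → R → R → Set p
    e   : R
    -_  : R → R
    ∞   : R
    isCBI : IsCBI setoid _∘_ e -_ ∞

Π-setoid : ∀ {i c ℓ} (A : Set i) → (A → Setoid c ℓ) → Setoid (i ⊔ c) (i ⊔ ℓ)
Π-setoid A S = record
  { Carrier = (a : A) → Setoid.Carrier (S a)
  ; _≈_ = λ x y → (a : A) → Setoid._≈_ (S a) (x a) (y a)
  ; isEquivalence = record
    { refl  = λ a → Setoid.refl (S a)
    ; sym   = λ p a → Setoid.sym (S a) (p a)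
    ; trans = λ p q a → Setoid.trans (S a) (p a) (q a)
    }
  }

module _ {i c ℓ p : Level} (A : Set i) (M : A → CBIModel c ℓ p) where
  open CBIModel

  Π-R : Setoid (i ⊔ c) (i ⊔ ℓ)
  Π-R = Π-setoid A (λ a → setoid (M a))

  Π-∘ : Setoid.Carrier Π-R → Setoid.Carrier Π-R → Setoid.Carrier Π-R → Set (i ⊔ p)
  Π-∘ x y w = (a : A) → _∘_ (M a) (x a) (y a) (w a)

  Π-e : Setoid.Carrier Π-R
  Π-e a = e (M a)

  Π-neg : Setoid.Carrier Π-R → Setoid.Carrier Π-R
  Π-neg x a = -_ (M a) (x a)

  Π-∞ : Setoid.Carrier Π-R
  Π-∞ a = ∞ (M a)

module Submission where

-- Every axiom of a CBI-model is a Π-statement (over elements of the carrier)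
-- whose conclusion is either an atomic fact about ∘ and ≈ or an existential
-- "∃ t. (x ∘ y) t × (t ∘ z) w" (associativity).  Atomic facts hold in the
-- product because they hold in every component.  For the existentials one
-- needs in addition to collect the componentwise witnesses t_a into a single
-- tuple (t_a)_a; this is the type-theoretic axiom of choice, which is simply
-- provable for Σ-types ('collect-witnesses' below).

open import Defs
open import Level using (Level; _⊔_)
open import Data.Product using (∃; _×_; _,_; proj₁; proj₂)
open import Relation.Binary.Bundles using (Setoid)

collect-witnesses : {i c p : Level} {A : Set i} {T : A → Set c}
                    (P : (a : A) → T a → Set p)
                  → ((a : A) → ∃ λ t → P a t)
                  → ∃ λ (t : (a : A) → T a) → (a : A) → P a (t a)
collect-witnesses P h = (λ a → proj₁ (h a)) , (λ a → proj₂ (h a))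

module ProductOfBBI
  {i c ℓ p : Level} {A : Set i} (S : A → Setoid c ℓ)
  (_∘_ : (a : A) → Setoid.Carrier (S a) → Setoid.Carrier (S a) → Setoid.Carrier (S a) → Set p)
  (e : (a : A) → Setoid.Carrier (S a))
  (bbi : (a : A) → IsBBI (S a) (_∘_ a) (e a))
  where

  R : Setoid (i ⊔ c) (i ⊔ ℓ)
  R = Π-setoid A S

  Carrier : Set (i ⊔ c)
  Carrier = Setoid.Carrier R

  _⊙_ : Carrier → Carrier → Carrier → Set (i ⊔ p)
  (x ⊙ y) w = (a : A) → _∘_ a (x a) (y a) (w a)

  -- Each associativity law has the shape "∃t. t ∈ X ∧ w ∈ t ∘ Z ⇒ ∃t. ...";
  -- it lifts to the product by splitting the hypothesis into components,
  -- using the component law, and collecting the new witnesses.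
  lift-exists : {Hyp Con : (a : A) → Setoid.Carrier (S a) → Set p}
                {Hyp′ Con′ : (a : A) → Setoid.Carrier (S a) → Set p}
              → (∀ a → (∃ λ t → Hyp a t × Hyp′ a t) → ∃ λ t → Con a t × Con′ a t)
              → (∃ λ (t : Carrier) → (∀ a → Hyp a (t a)) × (∀ a → Hyp′ a (t a)))
              → ∃ λ (t : Carrier) → (∀ a → Con a (t a)) × (∀ a → Con′ a (t a))
  lift-exists law (t , h , h′) with collect-witnesses _ (λ a → law a (t a , h a , h′ a))
  ... | (t′ , k) = t′ , (λ a → proj₁ (k a)) , (λ a → proj₂ (k a))

  product-isBBI : IsBBI R _⊙_ e
  product-isBBI = record
    { ∘-resp-elem = λ w≈w′ h a → B.∘-resp-elem a (w≈w′ a) (h a)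
    ; ∘-resp-≈    = λ x≈x′ y≈y′ h a → B.∘-resp-≈ a (x≈x′ a) (y≈y′ a) (h a)
    ; comm        = λ x y w h a → B.comm a (x a) (y a) (w a) (h a)
    ; assoc₁      = λ x y z w → lift-exists (λ a → B.assoc₁ a (x a) (y a) (z a) (w a))
    ; assoc₂      = λ x y z w → lift-exists (λ a → B.assoc₂ a (x a) (y a) (z a) (w a))
    ; unit₁       = λ r w h a → B.unit₁ a (r a) (w a) (h a)
    ; unit₂       = λ r a → B.unit₂ a (r a)
    }
    where module B a = IsBBI (bbi a)

  product-isCBI : (neg : (a : A) → Setoid.Carrier (S a) → Setoid.Carrier (S a))
                  (∞ : (a : A) → Setoid.Carrier (S a))
                → ((a : A) → IsCBI (S a) (_∘_ a) (e a) (neg a) (∞ a))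
                → IsCBI R _⊙_ e (λ x a → neg a (x a)) ∞
  product-isCBI neg ∞ cbi = record
    { isBBI      = product-isBBI
    ; inv        = λ x a → IsCBI.inv (cbi a) (x a)
    ; inv-unique = λ x y h a → IsCBI.inv-unique (cbi a) (x a) (y a) (h a)
    }

lemma5p11 : {i c ℓ p : Level} (A : Set i) (M : A → CBIModel c ℓ p)
    → IsCBI (Π-R A M) (Π-∘ A M) (Π-e A M) (Π-neg A M) (Π-∞ A M)
lemma5p11 A M =
  product-isCBI (λ a → -_ (M a)) (λ a → ∞ (M a)) cbi
  where
    open CBIModel
    cbi : (a : A) → IsCBI (setoid (M a)) (_∘_ (M a)) (e (M a)) (-_ (M a)) (∞ (M a))
    cbi a = isCBI (M a)
    open ProductOfBBI (λ a → setoid (M a)) (λ a → _∘_ (M a)) (λ a → e (M a))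
                      (λ a → IsCBI.isBBI (cbi a))
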